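{- For every 2D string $\mathcal{M}_{m\times n}$ it holds that $g_{rl}(\mathcal{M}_{m\times n}) \leq g(\mathcal{M}_{m\times n})$. Moreover, there are infinite string families where $g_{rl} = o(g)$.
   Context: A 2D string $\mathcal{M}_{m\times n}$ is an $m\times n$ matrix over a finite alphabet $\Sigma$. Horizontal concatenation, denoted here $A\oplus B$ (written in the paper with a rotated $\ominus$ symbol), places $B$ to the right of $A$ and requires equal numbers of rows; vertical concatenation $A\ominus B$ places $B$ below $A$ and requires equal numbers of columns. A 2D SLP for $\mathcal{M}$ is a context-free grammar $(V,\Sigma,R,S)$ uniquely generating $\mathcal{M}$ whose rules have the form $A\to a$ ($a\in\Sigma$), $A\to B\oplus C$ or $A\to B\ominus C$ ($B,C\in V$), with the natural expansions. A 2D RLSLP additionally allows run-length rules $A\to\oplus^k B$ and $A\to\ominus^k B$ for $k>1$, expanding to $k$ copies of $\mathtt{exp}(B)$ concatenated horizontally (resp. vertically). Grammar size is the sum of rule sizes: terminal rules size 1, all other rules size 2. $g$ (resp. $g_{rl}$) is the size of the smallest 2D SLP (resp. 2D RLSLP) generating the string. -}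

module Defs where

open import Data.Nat using (ℕ; zero; suc; _+_; _*_; _≤_)
open import Data.Fin using (Fin; zero; suc)
open import Data.Vec using (Vec; []; _∷_; _++_; zipWith; replicate; [_])
open import Data.Product using (Σ; _×_; _,_)
open import Data.Unit using (⊤)
open import Data.Empty using (⊥)
open import Relation.Binary.PropositionalEquality using (_≡_)

Mat : Set → ℕ → ℕ → Set
Mat A m n = Vec (Vec A n) m

_⊕_ : ∀ {A m n₁ n₂} → Mat A m n₁ → Mat A m n₂ → Mat A m (n₁ + n₂)
X ⊕ Y = zipWith _++_ X Y

_⊖_ : ∀ {A m₁ m₂ n} → Mat A m₁ n → Mat A m₂ n → Mat A (m₁ + m₂) n
X ⊖ Y = X ++ Y

hpow : ∀ {A m n} (k : ℕ) → Mat A m n → Mat A m (k * n)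
hpow {m = m} zero X = replicate m []
hpow (suc k) X = X ⊕ hpow k X

vpow : ∀ {A m n} (k : ℕ) → Mat A m n → Mat A (k * m) n
vpow zero X = []
vpow (suc k) X = X ⊖ vpow k X

data Rule (A : Set) (i : ℕ) : Set where
  term : A → Rule A i
  hor  : Fin i → Fin i → Rule A i
  ver  : Fin i → Fin i → Rule A i
  hrun : (k : ℕ) → 2 ≤ k → Fin i → Rule A i
  vrun : (k : ℕ) → 2 ≤ k → Fin i → Rule A i

-- A straight-line grammar with i nonterminals, as a snoc-list of rules;
-- each rule refers only to earlier nonterminals. Nonterminal index zero
-- is the most recently added rule; the start symbol is the last rule.
data Gram (A : Set) : ℕ → Set where
  []  : Gram A 0
  _▷_ : ∀ {i} → Gram A i → Rule A i → Gram A (suc i)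

data Gen {A : Set} : ∀ {i} → Gram A i → Fin i → ∀ {m n} → Mat A m n → Set where
  gen-term : ∀ {i} {G : Gram A i} {a} →
             Gen (G ▷ term a) zero [ [ a ] ]
  gen-hor  : ∀ {i} {G : Gram A i} {b c m n₁ n₂}
               {X : Mat A m n₁} {Y : Mat A m n₂} →
             Gen G b X → Gen G c Y → Gen (G ▷ hor b c) zero (X ⊕ Y)
  gen-ver  : ∀ {i} {G : Gram A i} {b c m₁ m₂ n}
               {X : Mat A m₁ n} {Y : Mat A m₂ n} →
             Gen G b X → Gen G c Y → Gen (G ▷ ver b c) zero (X ⊖ Y)
  gen-hrun : ∀ {i} {G : Gram A i} {k p b m n} {X : Mat A m n} →
             Gen G b X → Gen (G ▷ hrun k p b) zero (hpow k X)
  gen-vrun : ∀ {i} {G : Gram A i} {k p b m n} {X : Mat A m n} →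
             Gen G b X → Gen (G ▷ vrun k p b) zero (vpow k X)
  gen-there : ∀ {i} {G : Gram A i} {r j m n} {X : Mat A m n} →
             Gen G j X → Gen (G ▷ r) (suc j) X

Generates : ∀ {A i m n} → Gram A (suc i) → Mat A m n → Set
Generates G M = Gen G zero M

ruleSize : ∀ {A i} → Rule A i → ℕ
ruleSize (term _) = 1
ruleSize (hor _ _) = 2
ruleSize (ver _ _) = 2
ruleSize (hrun _ _ _) = 2
ruleSize (vrun _ _ _) = 2

size : ∀ {A i} → Gram A i → ℕ
size [] = 0
size (G ▷ r) = size G + ruleSize r

isPlain : ∀ {A i} → Rule A i → Set
isPlain (term _) = ⊤
isPlain (hor _ _) = ⊤
isPlain (ver _ _) = ⊤
isPlain (hrun _ _ _) = ⊥
isPlain (vrun _ _ _) = ⊥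

IsSLP : ∀ {A i} → Gram A i → Set
IsSLP [] = ⊤
IsSLP (G ▷ r) = IsSLP G × isPlain r

-- s is the size of the smallest 2D SLP generating M  (s = g(M)).
IsMinSLP : ∀ {A m n} → Mat A m n → ℕ → Set
IsMinSLP {A} M s =
  Σ ℕ (λ r → Σ (Gram A (suc r)) (λ G → IsSLP G × Generates G M × size G ≡ s))
  × (∀ r (G : Gram A (suc r)) → IsSLP G → Generates G M → s ≤ size G)

-- s is the size of the smallest 2D RLSLP generating M  (s = g_rl(M)).
IsMinRLSLP : ∀ {A m n} → Mat A m n → ℕ → Set
IsMinRLSLP {A} M s =
  Σ ℕ (λ r → Σ (Gram A (suc r)) (λ G → Generates G M × size G ≡ s))
  × (∀ r (G : Gram A (suc r)) → Generates G M → s ≤ size G)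

{-# OPTIONS --safe #-}
module Submission where

-- Every 2D SLP is a 2D RLSLP, hence g_rl ≤ g. For the separation take the
-- 1 × 2^k row a⋯a: one terminal rule and the run rule ⊕^(2^k) give g_rl = 3.
-- In an SLP each binary rule at most doubles the width of what it derives, so
-- reaching width 2^k takes k binary rules besides a terminal rule, i.e. size
-- at least 2k + 1, which repeated doubling attains.

open import Defs
open import Data.Nat using (ℕ; zero; suc; _+_; _*_; _^_; _≤_; _<_; z≤n; s≤s; z<s)
open import Data.Nat.Properties
open import Data.Nat.Tactic.RingSolver using (solve-∀)
open import Data.Fin using (Fin; zero)
open import Data.Vec using ([]; _∷_; _++_; replicate; [_])
open import Data.Product using (Σ; _×_; ∃; ∃₂; _,_)
open import Data.Unit using (tt)
open import Relation.Binary.PropositionalEquality using (_≡_; refl; sym; trans; cong; subst)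

s≡m+2*n⇒s+2≡m+2*[1+n] : ∀ {s} m n → s ≡ m + 2 * n → s + 2 ≡ m + 2 * suc n
s≡m+2*n⇒s+2≡m+2*[1+n] m n refl = m+2*n+2≡m+2*[1+n] m n
  where
  m+2*n+2≡m+2*[1+n] : ∀ m n → m + 2 * n + 2 ≡ m + 2 * suc n
  m+2*n+2≡m+2*[1+n] = solve-∀

2^m≤2^n⇒m≤n : ∀ {m n} → 2 ^ m ≤ 2 ^ n → m ≤ n
2^m≤2^n⇒m≤n 2^m≤2^n = ≮⇒≥ λ n<m → <⇒≱ (^-monoʳ-< 2 (s≤s (s≤s z≤n)) n<m) 2^m≤2^n

module _ {A : Set} where

  minRLSLP≤minSLP : ∀ {m n} {M : Mat A m n} {a b} → IsMinRLSLP M a → IsMinSLP M b → a ≤ b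
  minRLSLP≤minSLP (_ , rl-minimal) ((r , G , _ , G⇒M , refl) , _) = rl-minimal r G G⇒M

  #terminals #composites : ∀ {i} → Gram A i → ℕ
  #terminals [] = 0
  #terminals (G ▷ term _) = suc (#terminals G)
  #terminals (G ▷ hor _ _) = #terminals G
  #terminals (G ▷ ver _ _) = #terminals G
  #terminals (G ▷ hrun _ _ _) = #terminals G
  #terminals (G ▷ vrun _ _ _) = #terminals G

  #composites [] = 0
  #composites (G ▷ term _) = #composites G
  #composites (G ▷ hor _ _) = suc (#composites G)
  #composites (G ▷ ver _ _) = suc (#composites G)
  #composites (G ▷ hrun _ _ _) = suc (#composites G)
  #composites (G ▷ vrun _ _ _) = suc (#composites G)

  size≡#terminals+2*#composites : ∀ {i} (G : Gram A i) →
    size G ≡ #terminals G + 2 * #composites G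
  size≡#terminals+2*#composites [] = refl
  size≡#terminals+2*#composites (G ▷ term _) =
    trans (cong (_+ 1) (size≡#terminals+2*#composites G)) (+-comm _ 1)
  size≡#terminals+2*#composites (G ▷ hor _ _) =
    s≡m+2*n⇒s+2≡m+2*[1+n] _ _ (size≡#terminals+2*#composites G)
  size≡#terminals+2*#composites (G ▷ ver _ _) =
    s≡m+2*n⇒s+2≡m+2*[1+n] _ _ (size≡#terminals+2*#composites G)
  size≡#terminals+2*#composites (G ▷ hrun _ _ _) =
    s≡m+2*n⇒s+2≡m+2*[1+n] _ _ (size≡#terminals+2*#composites G)
  size≡#terminals+2*#composites (G ▷ vrun _ _ _) =
    s≡m+2*n⇒s+2≡m+2*[1+n] _ _ (size≡#terminals+2*#composites G)

  #terminals>0 : ∀ {i} (G : Gram A i) → Fin i → 0 < #terminals G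
  #terminals>0 (G ▷ term _) _ = z<s
  #terminals>0 (G ▷ hor b _) _ = #terminals>0 G b
  #terminals>0 (G ▷ ver b _) _ = #terminals>0 G b
  #terminals>0 (G ▷ hrun _ _ b) _ = #terminals>0 G b
  #terminals>0 (G ▷ vrun _ _ b) _ = #terminals>0 G b

  size>0 : ∀ {i} (G : Gram A i) → Fin i → 0 < size G
  size>0 G j = ≤-trans (#terminals>0 G j)
    (≤-trans (m≤m+n _ _) (≤-reflexive (sym (size≡#terminals+2*#composites G))))

  #composites-▷ : ∀ {i} (G : Gram A i) r → #composites G ≤ #composites (G ▷ r)
  #composites-▷ G (term _) = ≤-refl
  #composites-▷ G (hor _ _) = n≤1+n _
  #composites-▷ G (ver _ _) = n≤1+n _
  #composites-▷ G (hrun _ _ _) = n≤1+n _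
  #composites-▷ G (vrun _ _ _) = n≤1+n _

  width≤2^#composites : ∀ {i} {G : Gram A i} {j m n} {X : Mat A m n} →
    IsSLP G → Gen G j X → n ≤ 2 ^ #composites G
  width≤2^#composites {G = G ▷ _} _ gen-term = m^n>0 2 (#composites G)
  width≤2^#composites {G = G ▷ _} (slp , _) (gen-hor X Y) =
    +-mono-≤ (width≤2^#composites slp X)
             (≤-trans (width≤2^#composites slp Y) (m≤m+n (2 ^ #composites G) 0))
  width≤2^#composites {G = G ▷ _} (slp , _) (gen-ver X _) =
    ≤-trans (width≤2^#composites slp X) (^-monoʳ-≤ 2 (n≤1+n (#composites G)))
  width≤2^#composites (slp , ()) (gen-hrun _)
  width≤2^#composites (slp , ()) (gen-vrun _)
  width≤2^#composites {G = G ▷ r} (slp , _) (gen-there X) =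
    ≤-trans (width≤2^#composites slp X) (^-monoʳ-≤ 2 (#composites-▷ G r))

  slp-size≥1+2*k : ∀ {i} {G : Gram A (suc i)} {m k} {X : Mat A m (2 ^ k)} →
    IsSLP G → Generates G X → 1 + 2 * k ≤ size G
  slp-size≥1+2*k {G = G} {k = k} slp G⇒X = begin
    1 + 2 * k                        ≤⟨ +-mono-≤ (#terminals>0 G zero) (*-monoʳ-≤ 2 k≤c) ⟩
    #terminals G + 2 * #composites G ≡⟨ sym (size≡#terminals+2*#composites G) ⟩
    size G                           ∎
    where
    open ≤-Reasoning
    k≤c : k ≤ #composites G
    k≤c = 2^m≤2^n⇒m≤n (width≤2^#composites slp G⇒X)

  width≥2⇒size≥3 : ∀ {i} (G : Gram A (suc i)) {m n} {X : Mat A m n} →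
    Generates G X → 2 ≤ n → 3 ≤ size G
  width≥2⇒size≥3 (G ▷ term _) gen-term (s≤s ())
  width≥2⇒size≥3 (G ▷ hor b _) _ _ = +-monoˡ-≤ 2 (size>0 G b)
  width≥2⇒size≥3 (G ▷ ver b _) _ _ = +-monoˡ-≤ 2 (size>0 G b)
  width≥2⇒size≥3 (G ▷ hrun _ _ b) _ _ = +-monoˡ-≤ 2 (size>0 G b)
  width≥2⇒size≥3 (G ▷ vrun _ _ b) _ _ = +-monoˡ-≤ 2 (size>0 G b)

  unaryRow : (n : ℕ) → A → Mat A 1 n
  unaryRow n a = [ replicate n a ]

  unaryRow-⊕ : ∀ p q (a : A) → unaryRow p a ⊕ unaryRow q a ≡ unaryRow (p + q) a
  unaryRow-⊕ p q a = cong [_] (replicate-++ p)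
    where
    replicate-++ : ∀ p → replicate p a ++ replicate q a ≡ replicate (p + q) a
    replicate-++ zero = refl
    replicate-++ (suc p) = cong (a ∷_) (replicate-++ p)

  hpow-unaryRow : ∀ k (a : A) → hpow k (unaryRow 1 a) ≡ unaryRow (k * 1) a
  hpow-unaryRow zero a = refl
  hpow-unaryRow (suc k) a = cong (unaryRow 1 a ⊕_) (hpow-unaryRow k a)

  runGrammar : (n : ℕ) → 2 ≤ n → A → Gram A 2
  runGrammar n 2≤n a = ([] ▷ term a) ▷ hrun n 2≤n zero

  runGrammar-generates : ∀ n (2≤n : 2 ≤ n) (a : A) →
    Generates (runGrammar n 2≤n a) (unaryRow n a)
  runGrammar-generates n 2≤n a =
    subst (λ w → Generates (runGrammar n 2≤n a) (unaryRow w a)) (*-identityʳ n)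
      (subst (Generates (runGrammar n 2≤n a)) (hpow-unaryRow n a) (gen-hrun gen-term))

  doubling : (k : ℕ) → A → Gram A (suc k)
  doubling zero a = [] ▷ term a
  doubling (suc k) a = doubling k a ▷ hor zero zero

  doubling-isSLP : ∀ k (a : A) → IsSLP (doubling k a)
  doubling-isSLP zero a = tt , tt
  doubling-isSLP (suc k) a = doubling-isSLP k a , tt

  doubling-generates : ∀ k (a : A) → Generates (doubling k a) (unaryRow (2 ^ k) a)
  doubling-generates zero a = gen-term
  doubling-generates (suc k) a =
    subst (λ w → Generates (doubling (suc k) a) (unaryRow w a))
      (cong (2 ^ k +_) (sym (+-identityʳ (2 ^ k))))
      (subst (Generates (doubling (suc k) a)) (unaryRow-⊕ (2 ^ k) (2 ^ k) a)
        (gen-hor (doubling-generates k a) (doubling-generates k a)))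

  doubling-size : ∀ k (a : A) → size (doubling k a) ≡ 1 + 2 * k
  doubling-size zero a = refl
  doubling-size (suc k) a = s≡m+2*n⇒s+2≡m+2*[1+n] 1 k (doubling-size k a)

  unaryRow-IsMinRLSLP : ∀ {n} → 2 ≤ n → (a : A) → IsMinRLSLP (unaryRow n a) 3
  unaryRow-IsMinRLSLP {n} 2≤n a =
    (1 , runGrammar n 2≤n a , runGrammar-generates n 2≤n a , refl) ,
    λ _ G G⇒M → width≥2⇒size≥3 G G⇒M 2≤n

  unaryRow-IsMinSLP : ∀ k (a : A) → IsMinSLP (unaryRow (2 ^ k) a) (1 + 2 * k)
  unaryRow-IsMinSLP k a =
    (k , doubling k a , doubling-isSLP k a , doubling-generates k a , doubling-size k a) ,
    λ _ _ slp G⇒M → slp-size≥1+2*k {k = k} slp G⇒M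

proposition5 :
    (∀ σ m n (M : Mat (Fin σ) m n) (a b : ℕ) →
       IsMinRLSLP M a → IsMinSLP M b → a ≤ b)
    × (∀ σ → Σ (ℕ → ℕ) λ rows → Σ (ℕ → ℕ) λ cols →
         Σ ((k : ℕ) → Mat (Fin (suc σ)) (rows k) (cols k)) λ F →
           ∀ (c : ℕ) → ∃ λ K → ∀ k → K ≤ k →
             ∃₂ λ a b → IsMinRLSLP (F k) a × IsMinSLP (F k) b × c * a ≤ b)
proposition5 = (λ _ _ _ _ _ _ → minRLSLP≤minSLP) ,
  λ σ → (λ _ → 1) , (λ k → 2 ^ suc k) , (λ k → unaryRow (2 ^ suc k) zero) ,
    λ c → c * 3 , λ k c*3≤k →
      3 , 1 + 2 * suc k ,
      unaryRow-IsMinRLSLP (2≤2^[1+k] k) zero , unaryRow-IsMinSLP (suc k) zero ,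
      ≤-trans c*3≤k (k≤1+2*[1+k] k)
  where
  2≤2^[1+k] : ∀ k → 2 ≤ 2 ^ suc k
  2≤2^[1+k] k = *-monoʳ-≤ 2 (m^n>0 2 k)

  k≤1+2*[1+k] : ∀ k → k ≤ 1 + 2 * suc k
  k≤1+2*[1+k] k = ≤-trans (n≤1+n k) (≤-trans (m≤n*m (suc k) 2) (n≤1+n _))
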